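{- Let $l\geq 1$, $n\geq 2$ and $k\geq 3$ be integers and let $G=B_l(n,k)$. With $X(G)=\max\left\{\omega(G),\left\lceil \frac{|V(G)|+1}{\alpha_{\min}(G)+1}\right\rceil\right\}$, we have $X(G)\leq \chi_=(G)\leq X(G)+1$.
   Context: A clique is a maximal complete subgraph; $\omega(G)$ is the size of a largest clique. A simplicial vertex is a vertex belonging to exactly one clique. $B_1(n,k)=K_n$; for $l\geq 2$, $B_l(n,k)$ is obtained from $B_{l-1}(n,k)$ by attaching to each simplicial vertex $u$ of $B_{l-1}(n,k)$, $k-1$ new cliques of size $n$, each consisting of $u$ and $n-1$ new vertices (all new vertices distinct). $\alpha(G,v)$ is the maximum size of an independent set containing $v$, $\alpha_{\min}(G)=\min_v\alpha(G,v)$. An equitable $t$-coloring is a proper vertex coloring with colors $\{1,\dots,t\}$ in which every color class has size $\lfloor |V(G)|/t\rfloor$ or $\lceil |V(G)|/t\rceil$; $\chi_=(G)$ is the least $t$ admitting one. -}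

module Defs where

open import Data.Nat using (ℕ; zero; suc; _+_; _*_; _∸_; _≤_; _⊔_)
open import Data.Nat.DivMod using (_/_)
open import Data.Fin using (Fin; splitAt; remQuot)
open import Data.Fin.Subset using (Subset; _∈_; _⊆_; ∣_∣)
import Data.Fin as F
open import Data.Vec using (tabulate)
open import Data.Product using (Σ; ∃; ∃-syntax; _×_; _,_)
open import Data.Sum using (_⊎_; inj₁; inj₂)
open import Relation.Binary.PropositionalEquality using (_≡_; _≢_)
open import Relation.Nullary using (¬_)
open import Relation.Nullary.Decidable using (isYes)
open import Function.Definitions using (Injective)

record Graph : Set₁ where
  constructor mkGraph
  field
    size : ℕ
    E    : Fin size → Fin size → Set
open Graph public

V : Graph → Set
V G = Fin (size G)

K : ℕ → Graph
K n = mkGraph n (λ a b → a ≢ b)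

IsComplete : (G : Graph) → Subset (size G) → Set
IsComplete G C = ∀ a b → a ∈ C → b ∈ C → a ≢ b → E G a b

IsClique : (G : Graph) → Subset (size G) → Set
IsClique G C = IsComplete G C × (∀ C′ → IsComplete G C′ → C ⊆ C′ → C′ ⊆ C)

Simplicial : (G : Graph) → V G → Set
Simplicial G u = ∃[ C ] (IsClique G C × u ∈ C × (∀ C′ → IsClique G C′ → u ∈ C′ → C′ ≡ C))

IsCliqueNumber : Graph → ℕ → Set
IsCliqueNumber G w =
  (∃[ C ] (IsClique G C × ∣ C ∣ ≡ w)) × (∀ C → IsClique G C → ∣ C ∣ ≤ w)

IsIndependent : (G : Graph) → Subset (size G) → Set
IsIndependent G I = ∀ a b → a ∈ I → b ∈ I → ¬ E G a b

IsAlphaAt : (G : Graph) → V G → ℕ → Set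
IsAlphaAt G v b =
  (∃[ I ] (IsIndependent G I × v ∈ I × ∣ I ∣ ≡ b))
  × (∀ I → IsIndependent G I → v ∈ I → ∣ I ∣ ≤ b)

IsAlphaMin : Graph → ℕ → Set
IsAlphaMin G a = (∃[ v ] IsAlphaAt G v a) × (∀ v b → IsAlphaAt G v b → a ≤ b)

-- floor and ceiling of m / t (value 0 for t = 0, never used meaningfully)
⌊_/_⌋ : ℕ → ℕ → ℕ
⌊ m / zero ⌋  = 0
⌊ m / suc t ⌋ = m / suc t

⌈_/_⌉ : ℕ → ℕ → ℕ
⌈ m / zero ⌉  = 0
⌈ m / suc t ⌉ = (m + t) / suc t

colourClass : (G : Graph) {t : ℕ} → (V G → Fin t) → Fin t → Subset (size G)
colourClass G c i = tabulate (λ v → isYes (c v F.≟ i))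

EquitableColouring : (G : Graph) (t : ℕ) → (V G → Fin t) → Set
EquitableColouring G t c =
  (∀ a b → E G a b → c a ≢ c b)
  × (∀ i → ∣ colourClass G c i ∣ ≡ ⌊ size G / t ⌋ ⊎ ∣ colourClass G c i ∣ ≡ ⌈ size G / t ⌉)

EquitablyColourable : Graph → ℕ → Set
EquitablyColourable G t = Σ (V G → Fin t) (EquitableColouring G t)

IsEqChromatic : Graph → ℕ → Set
IsEqChromatic G χ = EquitablyColourable G χ × (∀ t → EquitablyColourable G t → χ ≤ t)

X : Graph → (ω αmin : ℕ) → ℕ
X G ω αmin = ω ⊔ ⌈ suc (size G) / suc αmin ⌉

-- Attaching: given G and an injective enumeration S : Fin m → V G of a
-- vertex set, attach to each S i exactly k-1 new cliques of size n, each
-- consisting of S i and n-1 new vertices (all new vertices distinct).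
-- New vertex (i , c , j) : i-th attachment vertex, c-th new clique,
-- j-th new vertex of that clique.

NewV : (m k n : ℕ) → Set
NewV m k n = Fin m × Fin (k ∸ 1) × Fin (n ∸ 1)

classify : ∀ N m k n → Fin (N + m * (k ∸ 1) * (n ∸ 1)) → Fin N ⊎ NewV m k n
classify N m k n x with splitAt N x
... | inj₁ a = inj₁ a
... | inj₂ y with remQuot (n ∸ 1) y
...   | (z , j) with remQuot (k ∸ 1) z
...     | (i , c) = inj₂ (i , c , j)

attachAdj : (G : Graph) {m : ℕ} (k n : ℕ) → (Fin m → V G) →
            V G ⊎ NewV m k n → V G ⊎ NewV m k n → Set
attachAdj G k n S (inj₁ a) (inj₁ b) = E G a b
attachAdj G k n S (inj₁ a) (inj₂ (i , c , j)) = a ≡ S i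
attachAdj G k n S (inj₂ (i , c , j)) (inj₁ b) = b ≡ S i
attachAdj G k n S (inj₂ (i , c , j)) (inj₂ (i′ , c′ , j′)) = i ≡ i′ × c ≡ c′ × j ≢ j′

attach : (G : Graph) (m k n : ℕ) → (Fin m → V G) → Graph
attach G m k n S = mkGraph (size G + m * (k ∸ 1) * (n ∸ 1))
  (λ x y → attachAdj G k n S (classify (size G) m k n x) (classify (size G) m k n y))

-- IsB l n k G : G is (a copy of) B_l(n,k), built by the recursive definition:
-- B_1 = K_n; B_l is B_{l-1} with k-1 new n-cliques attached at every
-- simplicial vertex of B_{l-1} (S enumerates exactly the simplicial vertices).
data IsB (n k : ℕ) : ℕ → Graph → Set₁ where
  base : IsB n k 1 (K n)
  step : ∀ {l G m} (S : Fin m → V G) →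
         IsB n k l G →
         Injective _≡_ _≡_ S →
         (∀ u → Simplicial G u → ∃[ i ] S i ≡ u) →
         (∀ i → Simplicial G (S i)) →
         IsB n k (suc l) (attach G m k n S)

-- Lower bound: a proper colouring uses distinct colours on a clique, so ω ≤ χ₌; and
-- in an equitable colouring the class of a vertex v with α(G,v) = αmin is an
-- independent set through v, so it has at most αmin elements while every other class
-- has at most αmin + 1, whence |V| < χ₌ (αmin + 1).
-- Upper bound: B_l(n,k) has a proper n-colouring with all classes of the same size
-- in which the simplicial vertices are also equidistributed over the colours.  This
-- survives an attaching step if the n - 1 new vertices of each clique attached at u
-- get the colours other than that of u: the attachment points are exactly the
-- simplicial vertices, so every colour gains the same number of vertices, and the
-- new simplicial vertices are exactly the new vertices.  Since B_l(n,k) contains an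
-- n-clique, χ₌ ≤ n ≤ ω ≤ X.
module Submission where

open import Defs

open import Data.Nat using (ℕ; zero; suc; _+_; _*_; _∸_; _≤_; _<_; z≤n; s≤s)
open import Data.Nat.DivMod using (_/_; m*n/n≡m; /-monoˡ-≤; +-distrib-/-∣ʳ; n/n≡1; m<n*o⇒m/o<n)
open import Data.Nat.Divisibility using (∣-refl)
open import Data.Nat.Properties
  using (+-*-semiring; +-assoc; +-identityʳ; +-cancelʳ-≡; *-distribˡ-+; *-identityˡ; *-identityʳ; *-zeroʳ; *-comm; +-mono-≤; +-mono-<-≤; +-mono-≤-<; n<1+n; ≤-trans; ≤-reflexive; ≤-pred; n≤1+n; m≤m+n; +-monoʳ-≤; +-comm; ⊔-lub; m≤m⊔n; module ≤-Reasoning)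
open import Algebra.Properties.Semiring.Sum +-*-semiring
  using (sum; sum-cong-≗; ∑-comm; ∑-distrib-+; *-distribˡ-sum; *-distribʳ-sum)
open import Data.Fin as Fin using (Fin; zero; suc; _↑ˡ_; _↑ʳ_; combine; splitAt; remQuot)
open import Data.Fin.Properties
  using (suc-injective; 0≢1+n; punchIn-injective; punchInᵢ≢i; punchIn-punchOut; splitAt-↑ˡ; splitAt-↑ʳ; splitAt⁻¹-↑ˡ; splitAt⁻¹-↑ʳ; remQuot-combine; combine-remQuot)
open import Data.Fin.Subset using (Subset; _∈_; _⊆_; ∣_∣; ⊤)
open import Data.Fin.Subset.Properties using (_∈?_; ⊆-antisym; ∈⊤; ∣⊤∣≡n)
open import Data.Vec using (_∷_; []; here; there; lookup; tabulate)
open import Data.Vec.Properties using ([]=⇒lookup; lookup⇒[]=; lookup∘tabulate)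
open import Data.Bool.Properties using (T-≡)
open import Data.Bool using (true; false)
open import Data.Sum as Sum using (_⊎_; inj₁; inj₂)
open import Function.Bundles using (Equivalence)
open import Data.Product using (∃-syntax; _,_; _×_; proj₁; proj₂)
open import Data.Empty using (⊥-elim)
open import Function using (_∘_)
open import Function.Definitions using (Injective)
open import Relation.Binary.PropositionalEquality
open import Relation.Nullary using (¬_; Dec; yes; no; _×-dec_)
open import Relation.Nullary.Decidable using (isYes; toWitness; fromWitness; map′)

sum-const : ∀ N c → sum {N} (λ _ → c) ≡ N * c
sum-const zero    c = refl
sum-const (suc N) c = cong (c +_) (sum-const N c)

sum-mono-≤ : ∀ {N} {f g : Fin N → ℕ} → (∀ x → f x ≤ g x) → sum f ≤ sum g
sum-mono-≤ {zero}  f≤g = z≤n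
sum-mono-≤ {suc N} f≤g = +-mono-≤ (f≤g zero) (sum-mono-≤ (f≤g ∘ suc))

sum-mono-< : ∀ {N} {f g : Fin N → ℕ} → (∀ x → f x ≤ g x) → ∀ x₀ → f x₀ < g x₀ → sum f < sum g
sum-mono-< f≤g zero     f<g = +-mono-<-≤ f<g (sum-mono-≤ (f≤g ∘ suc))
sum-mono-< f≤g (suc x₀) f<g = +-mono-≤-< (f≤g zero) (sum-mono-< (f≤g ∘ suc) x₀ f<g)

sum-↑ : ∀ N {M} (f : Fin (N + M) → ℕ) → sum f ≡ sum (λ a → f (a ↑ˡ M)) + sum (λ b → f (N ↑ʳ b))
sum-↑ zero    f = refl
sum-↑ (suc N) f = trans (cong (f zero +_) (sum-↑ N (f ∘ suc))) (sym (+-assoc (f zero) _ _))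

sum-combine : ∀ N {M} (f : Fin (N * M) → ℕ) → sum f ≡ sum (λ i → sum (λ j → f (combine {N} {M} i j)))
sum-combine zero    f = refl
sum-combine (suc N) {M} f =
  trans (sum-↑ M f) (cong (sum (λ j → f (j ↑ˡ N * M)) +_) (sum-combine N (λ y → f (M ↑ʳ y))))

𝟙 : ∀ {A : Set} → Dec A → ℕ
𝟙 (yes _) = 1
𝟙 (no _)  = 0

𝟙-yes : ∀ {A : Set} (d : Dec A) → A → 𝟙 d ≡ 1
𝟙-yes (yes _) _ = refl
𝟙-yes (no ¬a) a = ⊥-elim (¬a a)

𝟙-no : ∀ {A : Set} (d : Dec A) → ¬ A → 𝟙 d ≡ 0
𝟙-no (yes a) ¬a = ⊥-elim (¬a a)
𝟙-no (no _)  _  = refl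

𝟙-cong : ∀ {A B : Set} (d : Dec A) (e : Dec B) → (A → B) → (B → A) → 𝟙 d ≡ 𝟙 e
𝟙-cong (yes a) e A→B _   = sym (𝟙-yes e (A→B a))
𝟙-cong (no ¬a) e _   B→A = sym (𝟙-no e (¬a ∘ B→A))

sum-zero : ∀ {N} {f : Fin N → ℕ} → (∀ x → f x ≡ 0) → sum f ≡ 0
sum-zero {N} f≡0 = trans (sum-cong-≗ f≡0) (trans (sum-const N 0) (*-zeroʳ N))

sum-δ : ∀ {N} (u : Fin N) (g : Fin N → ℕ) → sum (λ x → 𝟙 (u Fin.≟ x) * g x) ≡ g u
sum-δ {suc N} zero g = trans
  (cong₂ _+_ (+-identityʳ (g zero)) (sum-zero λ x → cong (_* g (suc x)) (𝟙-no (zero Fin.≟ suc x) λ ())))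
  (+-identityʳ (g zero))
sum-δ {suc N} (suc u) g = trans
  (cong₂ _+_ (cong (_* g zero) (𝟙-no (suc u Fin.≟ zero) λ ()))
             (sum-cong-≗ λ x → cong (_* g (suc x)) (𝟙-cong (suc u Fin.≟ suc x) (u Fin.≟ x) suc-injective (cong suc))))
  (sum-δ u (g ∘ suc))

sum-𝟙-injective : ∀ {P Q} (f : Fin P → Fin Q) → Injective _≡_ _≡_ f →
                  ∀ {b} j₀ → f j₀ ≡ b → sum (λ j → 𝟙 (f j Fin.≟ b)) ≡ 1
sum-𝟙-injective f f-inj j₀ fj₀≡b = trans
  (sum-cong-≗ λ j → trans (𝟙-cong (f j Fin.≟ _) (j₀ Fin.≟ j) (λ fj≡b → f-inj (trans fj₀≡b (sym fj≡b))) (λ { refl → fj₀≡b }))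
                          (sym (*-identityʳ _)))
  (sum-δ j₀ (λ _ → 1))

sum-𝟙-outside : ∀ {P Q} (f : Fin P → Fin Q) {b} → (∀ j → f j ≢ b) → sum (λ j → 𝟙 (f j Fin.≟ b)) ≡ 0
sum-𝟙-outside f f≢b = sum-zero λ j → 𝟙-no (f j Fin.≟ _) (f≢b j)

sum-𝟙-punchIn : ∀ {p} (a b : Fin (suc p)) → sum (λ j → 𝟙 (Fin.punchIn a j Fin.≟ b)) + 𝟙 (a Fin.≟ b) ≡ 1
sum-𝟙-punchIn a b with a Fin.≟ b
... | yes refl = cong (_+ 1) (sum-𝟙-outside (Fin.punchIn a) (punchInᵢ≢i a))
... | no a≢b   = trans (+-identityʳ _) (sum-𝟙-injective (Fin.punchIn a) (punchIn-injective a _ _) (Fin.punchOut a≢b) (punchIn-punchOut a≢b))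

sum-fibres : ∀ {N t} (c : Fin N → Fin t) (g : Fin N → ℕ) →
             sum g ≡ sum (λ j → sum (λ v → 𝟙 (c v Fin.≟ j) * g v))
sum-fibres c g = trans (sum-cong-≗ λ v → sym (sum-δ (c v) (λ _ → g v))) (∑-comm λ v j → 𝟙 (c v Fin.≟ j) * g v)

sum-𝟙-atMostOne : ∀ {N} {P : Fin N → Set} (P? : ∀ x → Dec (P x)) →
                  (∀ x y → P x → P y → x ≡ y) → sum (λ x → 𝟙 (P? x)) ≤ 1
sum-𝟙-atMostOne {zero}  P? unique = z≤n
sum-𝟙-atMostOne {suc N} P? unique with P? zero
... | yes P0 = s≤s (≤-reflexive (sum-zero λ x → 𝟙-no (P? (suc x)) λ Px → 0≢1+n (unique zero (suc x) P0 Px)))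
... | no _   = sum-𝟙-atMostOne (P? ∘ suc) (λ x y Px Py → suc-injective (unique (suc x) (suc y) Px Py))

sum-enumeration : ∀ {m N} {P : Fin N → Set} (P? : ∀ v → Dec (P v)) (S : Fin m → Fin N) →
                  Injective _≡_ _≡_ S → (∀ v → P v → ∃[ i ] S i ≡ v) → (∀ i → P (S i)) →
                  (g : Fin N → ℕ) → sum (λ i → g (S i)) ≡ sum (λ v → 𝟙 (P? v) * g v)
sum-enumeration {m} P? S S-inj onto S∈P g = begin
  sum (λ i → g (S i))                                ≡⟨ sum-cong-≗ (λ i → sum-δ (S i) g) ⟨
  sum (λ i → sum (λ v → 𝟙 (S i Fin.≟ v) * g v))    ≡⟨ ∑-comm (λ i v → 𝟙 (S i Fin.≟ v) * g v) ⟩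
  sum (λ v → sum (λ i → 𝟙 (S i Fin.≟ v) * g v))    ≡⟨ sum-cong-≗ (λ v → fibre v) ⟩
  sum (λ v → 𝟙 (P? v) * g v)                         ∎
  where
  open ≡-Reasoning
  preimages : ∀ v → sum (λ i → 𝟙 (S i Fin.≟ v)) ≡ 𝟙 (P? v)
  preimages v with P? v
  ... | yes Pv = let i , Si≡v = onto v Pv in sum-𝟙-injective S S-inj i Si≡v
  ... | no ¬Pv = sum-𝟙-outside S λ { i refl → ¬Pv (S∈P i) }
  fibre : ∀ v → sum (λ i → 𝟙 (S i Fin.≟ v) * g v) ≡ 𝟙 (P? v) * g v
  fibre v = trans (sym (*-distribʳ-sum (g v) (λ i → 𝟙 (S i Fin.≟ v)))) (cong (_* g v) (preimages v))

sum-∈?-tail : ∀ {N} b (p : Subset N) → sum (λ x → 𝟙 (x ∈? p)) ≡ sum (λ x → 𝟙 (suc x ∈? b ∷ p))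
sum-∈?-tail b p = sum-cong-≗ λ x → 𝟙-cong (x ∈? p) (suc x ∈? b ∷ p) there λ { (there x∈p) → x∈p }

∣p∣≡sum : ∀ {N} (p : Subset N) → ∣ p ∣ ≡ sum (λ x → 𝟙 (x ∈? p))
∣p∣≡sum []          = refl
∣p∣≡sum (true ∷ p)  = cong suc (trans (∣p∣≡sum p) (sum-∈?-tail true p))
∣p∣≡sum (false ∷ p) = trans (∣p∣≡sum p) (cong₂ _+_ (sym (𝟙-no (zero ∈? false ∷ p) λ ())) (sum-∈?-tail false p))

∈-tabulate⁺ : ∀ {N} {P : Fin N → Set} (P? : ∀ x → Dec (P x)) {x} → P x → x ∈ tabulate (λ y → isYes (P? y))
∈-tabulate⁺ P? {x} Px = lookup⇒[]= x _ (trans (lookup∘tabulate _ x) (Equivalence.to T-≡ (fromWitness Px)))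

∈-tabulate⁻ : ∀ {N} {P : Fin N → Set} (P? : ∀ x → Dec (P x)) {x} → x ∈ tabulate (λ y → isYes (P? y)) → P x
∈-tabulate⁻ P? {x} x∈ = toWitness (Equivalence.from T-≡ (trans (sym (lookup∘tabulate _ x)) ([]=⇒lookup x∈)))

𝟙-× : ∀ {A B : Set} (d : Dec A) (e : Dec B) → 𝟙 d * 𝟙 e ≡ 𝟙 (d ×-dec e)
𝟙-× (yes _) (yes _) = refl
𝟙-× (yes _) (no _)  = refl
𝟙-× (no _)  _       = refl

Proper : (G : Graph) {t : ℕ} → (V G → Fin t) → Set
Proper G c = ∀ a b → E G a b → c a ≢ c b

classSize : (G : Graph) {t : ℕ} → (V G → Fin t) → Fin t → ℕ
classSize G c j = sum (λ v → 𝟙 (c v Fin.≟ j))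

module _ (G : Graph) {t : ℕ} (c : V G → Fin t) where

  ∣colourClass∣≡classSize : ∀ j → ∣ colourClass G c j ∣ ≡ classSize G c j
  ∣colourClass∣≡classSize j = trans (∣p∣≡sum (colourClass G c j)) (sum-cong-≗ λ v →
    𝟙-cong (v ∈? colourClass G c j) (c v Fin.≟ j) (∈-tabulate⁻ (λ u → c u Fin.≟ j)) (∈-tabulate⁺ (λ u → c u Fin.≟ j)))

  size≡∑classSize : size G ≡ sum (classSize G c)
  size≡∑classSize = begin
    size G                                          ≡⟨ *-identityʳ (size G) ⟨
    size G * 1                                      ≡⟨ sum-const (size G) 1 ⟨
    sum {size G} (λ _ → 1)                          ≡⟨ sum-fibres c (λ _ → 1) ⟩
    sum (λ j → sum (λ v → 𝟙 (c v Fin.≟ j) * 1))    ≡⟨ sum-cong-≗ (λ j → sum-cong-≗ λ v → *-identityʳ (𝟙 (c v Fin.≟ j))) ⟩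
    sum (classSize G c)                             ∎
    where open ≡-Reasoning

  colourClass-independent : Proper G c → ∀ j → IsIndependent G (colourClass G c j)
  colourClass-independent proper j a b a∈ b∈ ab =
    proper a b ab (trans (∈-tabulate⁻ (λ u → c u Fin.≟ j) a∈) (sym (∈-tabulate⁻ (λ u → c u Fin.≟ j) b∈)))

  ∣complete∣≤colours : Proper G c → ∀ C → IsComplete G C → ∣ C ∣ ≤ t
  ∣complete∣≤colours proper C complete = begin
    ∣ C ∣                                                          ≡⟨ ∣p∣≡sum C ⟩
    sum (λ v → 𝟙 (v ∈? C))                                         ≡⟨ sum-fibres c _ ⟩
    sum (λ j → sum (λ v → 𝟙 (c v Fin.≟ j) * 𝟙 (v ∈? C)))          ≤⟨ sum-mono-≤ atMostOne ⟩
    sum {t} (λ _ → 1)                                              ≡⟨ sum-const t 1 ⟩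
    t * 1                                                          ≡⟨ *-identityʳ t ⟩
    t                                                              ∎
    where
    open ≤-Reasoning
    atMostOne : ∀ j → sum (λ v → 𝟙 (c v Fin.≟ j) * 𝟙 (v ∈? C)) ≤ 1
    atMostOne j = subst (_≤ 1) (sum-cong-≗ λ v → sym (𝟙-× (c v Fin.≟ j) (v ∈? C)))
      (sum-𝟙-atMostOne (λ v → (c v Fin.≟ j) ×-dec (v ∈? C)) unique)
      where
      unique : ∀ a b → c a ≡ j × a ∈ C → c b ≡ j × b ∈ C → a ≡ b
      unique a b (ca≡j , a∈C) (cb≡j , b∈C) with a Fin.≟ b
      ... | yes a≡b = a≡b
      ... | no a≢b  = ⊥-elim (proper a b (complete a b a∈C b∈C a≢b) (trans ca≡j (sym cb≡j)))

⌈/⌉≤suc⌊/⌋ : ∀ N t → ⌈ N / suc t ⌉ ≤ suc ⌊ N / suc t ⌋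
⌈/⌉≤suc⌊/⌋ N t = begin
  (N + t) / suc t              ≤⟨ /-monoˡ-≤ (suc t) (+-monoʳ-≤ N (n≤1+n t)) ⟩
  (N + suc t) / suc t          ≡⟨ +-distrib-/-∣ʳ N ∣-refl ⟩
  N / suc t + suc t / suc t    ≡⟨ cong (N / suc t +_) (n/n≡1 (suc t)) ⟩
  N / suc t + 1                ≡⟨ +-comm (N / suc t) 1 ⟩
  suc (N / suc t)              ∎
  where open ≤-Reasoning

⌊/⌋≤⌈/⌉ : ∀ N t → ⌊ N / suc t ⌋ ≤ ⌈ N / suc t ⌉
⌊/⌋≤⌈/⌉ N t = /-monoˡ-≤ (suc t) (m≤m+n N t)

⌈suc/suc⌉≤ : ∀ {N t a} → N < t * suc a → ⌈ suc N / suc a ⌉ ≤ t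
⌈suc/suc⌉≤ {N} {t} {a} N<t*[1+a] = ≤-pred (m<n*o⇒m/o<n (begin-strict
  suc N + a          ≡⟨ +-comm (suc N) a ⟩
  a + suc N          <⟨ +-mono-<-≤ (n<1+n a) N<t*[1+a] ⟩
  suc a + t * suc a  ∎))
  where open ≤-Reasoning

⌈suc/suc⌉≤colours : ∀ G {t} (c : V G → Fin t) → EquitableColouring G t c →
                    ∀ a → IsAlphaMin G a → ⌈ suc (size G) / suc a ⌉ ≤ t
⌈suc/suc⌉≤colours G {zero} c _ a ((v₀ , _) , _) with c v₀
... | ()
⌈suc/suc⌉≤colours G {suc t} c (proper , equitable) a ((v₀ , _ , α≤a) , _) = ⌈suc/suc⌉≤ (begin-strict
  size G                     ≡⟨ size≡∑classSize G c ⟩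
  sum (classSize G c)        <⟨ sum-mono-< {g = λ _ → suc a} classSize≤ (c v₀) (s≤s class₀≤a) ⟩
  sum {suc t} (λ _ → suc a)  ≡⟨ sum-const (suc t) (suc a) ⟩
  suc t * suc a              ∎)
  where
  open ≤-Reasoning
  N = size G
  equitable′ : ∀ j → classSize G c j ≡ ⌊ N / suc t ⌋ ⊎ classSize G c j ≡ ⌈ N / suc t ⌉
  equitable′ j = Sum.map (trans (sym (∣colourClass∣≡classSize G c j))) (trans (sym (∣colourClass∣≡classSize G c j))) (equitable j)
  class₀≤a : classSize G c (c v₀) ≤ a
  class₀≤a = subst (_≤ a) (∣colourClass∣≡classSize G c (c v₀))
    (α≤a _ (colourClass-independent G c proper (c v₀)) (∈-tabulate⁺ (λ u → c u Fin.≟ c v₀) refl))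
  ⌊/⌋≤a : ⌊ N / suc t ⌋ ≤ a
  ⌊/⌋≤a with equitable′ (c v₀)
  ... | inj₁ class₀≡⌊/⌋ = subst (_≤ a) class₀≡⌊/⌋ class₀≤a
  ... | inj₂ class₀≡⌈/⌉ = ≤-trans (⌊/⌋≤⌈/⌉ N t) (subst (_≤ a) class₀≡⌈/⌉ class₀≤a)
  classSize≤ : ∀ j → classSize G c j ≤ suc a
  classSize≤ j with equitable′ j
  ... | inj₁ class≡⌊/⌋ = subst (_≤ suc a) (sym class≡⌊/⌋) (≤-trans ⌊/⌋≤a (n≤1+n a))
  ... | inj₂ class≡⌈/⌉ = subst (_≤ suc a) (sym class≡⌈/⌉) (≤-trans (⌈/⌉≤suc⌊/⌋ N t) (s≤s ⌊/⌋≤a))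

UniqueCliqueThrough : (G : Graph) → Subset (size G) → V G → Set
UniqueCliqueThrough G C u = IsClique G C × u ∈ C × (∀ C′ → IsClique G C′ → u ∈ C′ → C′ ≡ C)

closedNeighbourhood-uniqueClique : ∀ G (P : Subset (size G)) x₀ → x₀ ∈ P → IsComplete G P →
                                   (∀ x → x ≢ x₀ → E G x x₀ → x ∈ P) → UniqueCliqueThrough G P x₀
closedNeighbourhood-uniqueClique G P x₀ x₀∈P P-complete nbrs∈P =
  (P-complete , λ D D-complete P⊆D → complete⊆P D D-complete (P⊆D x₀∈P)) , x₀∈P , unique
  where
  complete⊆P : ∀ D → IsComplete G D → x₀ ∈ D → D ⊆ P
  complete⊆P D D-complete x₀∈D {x} x∈D with x Fin.≟ x₀
  ... | yes refl = x₀∈P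
  ... | no x≢x₀  = nbrs∈P x x≢x₀ (D-complete x x₀ x∈D x₀∈D x≢x₀)
  unique : ∀ C → IsClique G C → x₀ ∈ C → C ≡ P
  unique C (C-complete , C-maximal) x₀∈C =
    ⊆-antisym (complete⊆P C C-complete x₀∈C) (C-maximal P P-complete (complete⊆P C C-complete x₀∈C))

-- One attaching step

module Attach (G : Graph) {m : ℕ} (k n : ℕ) (S : Fin m → V G) where

  G′ : Graph
  G′ = attach G m k n S

  W : Set
  W = V G ⊎ NewV m k n

  N M : ℕ
  N = size G
  M = m * (k ∸ 1) * (n ∸ 1)

  toW : V G′ → W
  toW = classify N m k n

  fromW : W → V G′
  fromW (inj₁ a)           = a ↑ˡ M
  fromW (inj₂ (i , c , j)) = N ↑ʳ combine (combine i c) j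

  toW-fromW : ∀ w → toW (fromW w) ≡ w
  toW-fromW (inj₁ a) rewrite splitAt-↑ˡ N a M = refl
  toW-fromW (inj₂ (i , c , j)) rewrite splitAt-↑ʳ N M (combine (combine i c) j) = trans
    (cong (λ (ic , j) → inj₂ (proj₁ (remQuot {m} (k ∸ 1) ic) , proj₂ (remQuot {m} (k ∸ 1) ic) , j))
          (remQuot-combine {m * (k ∸ 1)} {n ∸ 1} (combine i c) j))
    (cong (λ (i , c) → inj₂ (i , c , j)) (remQuot-combine {m} {k ∸ 1} i c))

  fromW-toW : ∀ x → fromW (toW x) ≡ x
  fromW-toW x with splitAt N x in eq
  ... | inj₁ a = splitAt⁻¹-↑ˡ eq
  ... | inj₂ y = trans
    (cong (λ u → N ↑ʳ combine u (proj₂ (remQuot {m * (k ∸ 1)} (n ∸ 1) y)))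
          (combine-remQuot {m} (k ∸ 1) (proj₁ (remQuot {m * (k ∸ 1)} (n ∸ 1) y))))
    (trans (cong (N ↑ʳ_) (combine-remQuot {m * (k ∸ 1)} (n ∸ 1) y)) (splitAt⁻¹-↑ʳ eq))

  toW-injective : ∀ {x y} → toW x ≡ toW y → x ≡ y
  toW-injective {x} {y} eq = trans (sym (fromW-toW x)) (trans (cong fromW eq) (fromW-toW y))

  old : V G → V G′
  old a = fromW (inj₁ a)

  old-injective : ∀ {a b} → old a ≡ old b → a ≡ b
  old-injective {a} {b} eq with trans (sym (toW-fromW (inj₁ a))) (trans (cong toW eq) (toW-fromW (inj₁ b)))
  ... | refl = refl

  -- E G′ x y unfolds to Adj (toW x) (toW y).
  Adj : W → W → Set
  Adj = attachAdj G k n S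

  sum-attach : (h : W → ℕ) → sum (λ x → h (toW x)) ≡
    sum (λ a → h (inj₁ a)) + sum (λ i → sum (λ c → sum (λ j → h (inj₂ (i , c , j)))))
  sum-attach h = trans (sum-↑ N (h ∘ toW)) (cong₂ _+_
    (sum-cong-≗ λ a → cong h (toW-fromW (inj₁ a)))
    (trans (sum-combine (m * (k ∸ 1)) _) (trans (sum-combine m _)
      (sum-cong-≗ λ i → sum-cong-≗ λ c → sum-cong-≗ λ j → cong h (toW-fromW (inj₂ (i , c , j)))))))

  data Attached (i : Fin m) (c : Fin (k ∸ 1)) : W → Set where
    root : Attached i c (inj₁ (S i))
    leaf : ∀ j → Attached i c (inj₂ (i , c , j))

  attached? : ∀ i c w → Dec (Attached i c w)
  attached? i c (inj₁ a) with a Fin.≟ S i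
  ... | yes refl = yes root
  ... | no a≢Si  = no λ { root → a≢Si refl }
  attached? i c (inj₂ (i′ , c′ , j)) with i Fin.≟ i′ | c Fin.≟ c′
  ... | yes refl | yes refl = yes (leaf j)
  ... | no i≢i′  | _        = no λ { (leaf _) → i≢i′ refl }
  ... | yes _    | no c≢c′  = no λ { (leaf _) → c≢c′ refl }

  attachedClique : Fin m → Fin (k ∸ 1) → Subset (size G′)
  attachedClique i c = tabulate (λ x → isYes (attached? i c (toW x)))

  attached-adjacent : ∀ {i c w w′} → Attached i c w → Attached i c w′ → w ≢ w′ → Adj w w′
  attached-adjacent root     root      w≢w′ = ⊥-elim (w≢w′ refl)
  attached-adjacent root     (leaf j)  _    = refl
  attached-adjacent (leaf j) root      _    = refl
  attached-adjacent (leaf j) (leaf j′) w≢w′ = refl , refl , λ { refl → w≢w′ refl }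

  attached-closed : ∀ {i c j} w → Adj w (inj₂ (i , c , j)) → Attached i c w
  attached-closed (inj₁ _)           refl           = root
  attached-closed (inj₂ (_ , _ , j)) (refl , refl , _) = leaf j

  ∈attachedClique⁺ : ∀ {i c x} → Attached i c (toW x) → x ∈ attachedClique i c
  ∈attachedClique⁺ {i} {c} = ∈-tabulate⁺ (λ x → attached? i c (toW x))

  ∈attachedClique⁻ : ∀ {i c x} → x ∈ attachedClique i c → Attached i c (toW x)
  ∈attachedClique⁻ {i} {c} = ∈-tabulate⁻ (λ x → attached? i c (toW x))

  leaf∈attachedClique : ∀ i c j → fromW (inj₂ (i , c , j)) ∈ attachedClique i c
  leaf∈attachedClique i c j = ∈attachedClique⁺ (subst (Attached i c) (sym (toW-fromW (inj₂ (i , c , j)))) (leaf j))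

  root∈attachedClique : ∀ i c → old (S i) ∈ attachedClique i c
  root∈attachedClique i c = ∈attachedClique⁺ (subst (Attached i c) (sym (toW-fromW (inj₁ (S i)))) root)

  attachedClique-unique : ∀ i c j → UniqueCliqueThrough G′ (attachedClique i c) (fromW (inj₂ (i , c , j)))
  attachedClique-unique i c j =
    closedNeighbourhood-uniqueClique G′ (attachedClique i c) _ (leaf∈attachedClique i c j) complete closed
    where
    complete : IsComplete G′ (attachedClique i c)
    complete x y x∈ y∈ x≢y = attached-adjacent (∈attachedClique⁻ x∈) (∈attachedClique⁻ y∈) (x≢y ∘ toW-injective)
    closed : ∀ x → x ≢ fromW (inj₂ (i , c , j)) → E G′ x (fromW (inj₂ (i , c , j))) → x ∈ attachedClique i c
    closed x _ x~leaf = ∈attachedClique⁺ (attached-closed (toW x) (subst (Adj (toW x)) (toW-fromW (inj₂ (i , c , j))) x~leaf))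

  leaf-simplicial : ∀ i c j → Simplicial G′ (fromW (inj₂ (i , c , j)))
  leaf-simplicial i c j = attachedClique i c , attachedClique-unique i c j

  -- Two attached cliques meet at S i, so it lies in two distinct cliques.
  root-not-simplicial : ∀ {c₀ c₁} → c₀ ≢ c₁ → Fin (n ∸ 1) → ∀ i → ¬ Simplicial G′ (old (S i))
  root-not-simplicial {c₀} {c₁} c₀≢c₁ j i (_ , _ , _ , unique) = c₀≢c₁ (c₀≡c₁ (∈attachedClique⁻ leaf₀∈Q₁))
    where
    Q₀≡Q₁ : attachedClique i c₀ ≡ attachedClique i c₁
    Q₀≡Q₁ = trans (unique _ (proj₁ (attachedClique-unique i c₀ j)) (root∈attachedClique i c₀))
              (sym (unique _ (proj₁ (attachedClique-unique i c₁ j)) (root∈attachedClique i c₁)))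
    leaf₀∈Q₁ : fromW (inj₂ (i , c₀ , j)) ∈ attachedClique i c₁
    leaf₀∈Q₁ = subst (fromW (inj₂ (i , c₀ , j)) ∈_) Q₀≡Q₁ (leaf∈attachedClique i c₀ j)
    c₀≡c₁ : Attached i c₁ (toW (fromW (inj₂ (i , c₀ , j)))) → c₀ ≡ c₁
    c₀≡c₁ a rewrite toW-fromW (inj₂ (i , c₀ , j)) with a
    ... | leaf _ = refl

  data OldIn (D : Subset N) : W → Set where
    old∈ : ∀ {a} → a ∈ D → OldIn D (inj₁ a)

  oldIn? : ∀ D w → Dec (OldIn D w)
  oldIn? D (inj₁ a) with a ∈? D
  ... | yes a∈D = yes (old∈ a∈D)
  ... | no a∉D  = no λ { (old∈ a∈D) → a∉D a∈D }
  oldIn? D (inj₂ _) = no λ ()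

  lift : Subset N → Subset (size G′)
  lift D = tabulate (λ x → isYes (oldIn? D (toW x)))

  restrict : Subset (size G′) → Subset N
  restrict C = tabulate (λ a → isYes (old a ∈? C))

  old∈lift : ∀ {D a} → a ∈ D → old a ∈ lift D
  old∈lift {D} {a} a∈D = ∈-tabulate⁺ (λ x → oldIn? D (toW x)) (subst (OldIn D) (sym (toW-fromW (inj₁ a))) (old∈ a∈D))

  old∈lift⁻ : ∀ {D a} → old a ∈ lift D → a ∈ D
  old∈lift⁻ {D} {a} a∈ with toW (old a) | toW-fromW (inj₁ a) | ∈-tabulate⁻ (λ x → oldIn? D (toW x)) a∈
  ... | _ | refl | old∈ a∈D = a∈D

  ∈lift⁻ : ∀ {D x} → x ∈ lift D → ∃[ a ] (x ≡ old a × a ∈ D)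
  ∈lift⁻ {D} {x} x∈ with toW x | fromW-toW x | ∈-tabulate⁻ (λ x → oldIn? D (toW x)) x∈
  ... | _ | refl | old∈ {a} a∈D = a , refl , a∈D

  ∈restrict⁺ : ∀ {C a} → old a ∈ C → a ∈ restrict C
  ∈restrict⁺ {C} = ∈-tabulate⁺ (λ a → old a ∈? C)

  ∈restrict⁻ : ∀ {C a} → a ∈ restrict C → old a ∈ C
  ∈restrict⁻ {C} = ∈-tabulate⁻ (λ a → old a ∈? C)

  ∣lift∣≡∣∣ : ∀ D → ∣ lift D ∣ ≡ ∣ D ∣
  ∣lift∣≡∣∣ D = begin
    ∣ lift D ∣                                                         ≡⟨ ∣p∣≡sum (lift D) ⟩
    sum (λ x → 𝟙 (x ∈? lift D))                                        ≡⟨ sum-cong-≗ membership ⟩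
    sum (λ x → 𝟙 (oldIn? D (toW x)))                                   ≡⟨ sum-attach (λ w → 𝟙 (oldIn? D w)) ⟩
    sum (λ a → 𝟙 (oldIn? D (inj₁ a))) + sum {m} (λ i → sum {k ∸ 1} (λ c → sum {n ∸ 1} (λ j → 0)))
      ≡⟨ cong₂ _+_ (sum-cong-≗ λ a → 𝟙-cong (oldIn? D (inj₁ a)) (a ∈? D) (λ { (old∈ a∈D) → a∈D }) old∈)
                   no-new ⟩
    sum (λ a → 𝟙 (a ∈? D)) + 0                                         ≡⟨ +-identityʳ (sum (λ a → 𝟙 (a ∈? D))) ⟩
    sum (λ a → 𝟙 (a ∈? D))                                             ≡⟨ ∣p∣≡sum D ⟨
    ∣ D ∣                                                              ∎
    where
    open ≡-Reasoning
    no-new : sum {m} (λ i → sum {k ∸ 1} (λ c → sum {n ∸ 1} (λ j → 0))) ≡ 0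
    no-new = sum-zero {m} λ i → sum-zero {k ∸ 1} λ c → sum-zero {n ∸ 1} λ j → refl
    membership : ∀ x → 𝟙 (x ∈? lift D) ≡ 𝟙 (oldIn? D (toW x))
    membership x = 𝟙-cong (x ∈? lift D) (oldIn? D (toW x))
      (∈-tabulate⁻ (λ x → oldIn? D (toW x))) (∈-tabulate⁺ (λ x → oldIn? D (toW x)))

  old-adjacent⁺ : ∀ {a b} → E G a b → E G′ (old a) (old b)
  old-adjacent⁺ {a} {b} = subst₂ Adj (sym (toW-fromW (inj₁ a))) (sym (toW-fromW (inj₁ b)))

  old-adjacent⁻ : ∀ {a b} → E G′ (old a) (old b) → E G a b
  old-adjacent⁻ {a} {b} = subst₂ Adj (toW-fromW (inj₁ a)) (toW-fromW (inj₁ b))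

  lift-complete : ∀ D → IsComplete G D → IsComplete G′ (lift D)
  lift-complete D D-complete x y x∈ y∈ x≢y with ∈lift⁻ x∈ | ∈lift⁻ y∈
  ... | a , refl , a∈D | b , refl , b∈D = old-adjacent⁺ (D-complete a b a∈D b∈D λ { refl → x≢y refl })

  restrict-complete : ∀ C → IsComplete G′ C → IsComplete G (restrict C)
  restrict-complete C C-complete a b a∈ b∈ a≢b =
    old-adjacent⁻ (C-complete (old a) (old b) (∈restrict⁻ a∈) (∈restrict⁻ b∈) (a≢b ∘ old-injective))

  restrict-lift : ∀ D → restrict (lift D) ≡ D
  restrict-lift D = ⊆-antisym (old∈lift⁻ ∘ ∈restrict⁻) (∈restrict⁺ ∘ old∈lift)

  -- A new vertex (i , c , j) has S i as its only old neighbour.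
  complete⊆old : ∀ C → IsComplete G′ C → (∀ i → ∃[ a ] (old a ∈ C × a ≢ S i)) → ∀ {x} → x ∈ C → ∃[ a ] x ≡ old a
  complete⊆old C C-complete avoids {x} x∈C with toW x | fromW-toW x
  ... | inj₁ a           | refl = a , refl
  ... | inj₂ (i , c , j) | refl = ⊥-elim (a≢Si (subst₂ Adj (toW-fromW (inj₂ (i , c , j))) (toW-fromW (inj₁ a))
                                    (C-complete _ (old a) x∈C a∈C new≢old)))
    where
    a = proj₁ (avoids i)
    a∈C = proj₁ (proj₂ (avoids i))
    a≢Si = proj₂ (proj₂ (avoids i))
    new≢old : fromW (inj₂ (i , c , j)) ≢ old a
    new≢old eq with trans (sym (toW-fromW (inj₂ (i , c , j)))) (trans (cong toW eq) (toW-fromW (inj₁ a)))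
    ... | ()

  lift-clique : ∀ D → IsClique G D → (∀ i → ∃[ a ] (a ∈ D × a ≢ S i)) → IsClique G′ (lift D)
  lift-clique D (D-complete , D-maximal) avoids = lift-complete D D-complete , maximal
    where
    maximal : ∀ C → IsComplete G′ C → lift D ⊆ C → C ⊆ lift D
    maximal C C-complete lift⊆C x∈C
      with complete⊆old C C-complete (λ i → let a , a∈D , a≢Si = avoids i in a , lift⊆C (old∈lift a∈D) , a≢Si) x∈C
    ... | a , refl = old∈lift (D-maximal (restrict C) (restrict-complete C C-complete)
                                 (∈restrict⁺ ∘ lift⊆C ∘ old∈lift) (∈restrict⁺ x∈C))

  restrict-clique : ∀ C → IsClique G′ C → (∀ i → ∃[ a ] (old a ∈ C × a ≢ S i)) → IsClique G (restrict C)
  restrict-clique C (C-complete , C-maximal) avoids = restrict-complete C C-complete , maximal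
    where
    maximal : ∀ D → IsComplete G D → restrict C ⊆ D → D ⊆ restrict C
    maximal D D-complete restrict⊆D = ∈restrict⁺ ∘ C-maximal (lift D) (lift-complete D D-complete) C⊆lift ∘ old∈lift
      where
      C⊆lift : C ⊆ lift D
      C⊆lift x∈C with complete⊆old C C-complete avoids x∈C
      ... | a , refl = old∈lift (restrict⊆D (∈restrict⁺ x∈C))

  -- Cliques through an old vertex other than the S i correspond to cliques of G.
  old-not-simplicial : ∀ v → ¬ Simplicial G v → (∀ i → v ≢ S i) → ¬ Simplicial G′ (old v)
  old-not-simplicial v ¬simplicial v≢S (C , C-clique , v∈C , unique) =
    ¬simplicial (restrict C , restrict-clique C C-clique (λ i → v , v∈C , v≢S i) , ∈restrict⁺ v∈C , unique′)
    where
    unique′ : ∀ D → IsClique G D → v ∈ D → D ≡ restrict C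
    unique′ D D-clique v∈D = trans (sym (restrict-lift D))
      (cong restrict (unique (lift D) (lift-clique D D-clique (λ i → v , v∈D , v≢S i)) (old∈lift v∈D)))

-- The invariant of the construction

record Balanced (n : ℕ) (G : Graph) : Set where
  field
    colour             : V G → Fin n
    colour-proper      : Proper G colour
    classSize-uniform  : ∀ j j′ → classSize G colour j ≡ classSize G colour j′
    simplicial?        : ∀ v → Dec (Simplicial G v)
    simplicial-uniform : ∀ j j′ → sum (λ v → 𝟙 (simplicial? v) * 𝟙 (colour v Fin.≟ j))
                                ≡ sum (λ v → 𝟙 (simplicial? v) * 𝟙 (colour v Fin.≟ j′))
    clique             : Subset (size G)
    clique-isClique    : IsClique G clique
    ∣clique∣≡n         : ∣ clique ∣ ≡ n
    -- Every attachment point differs from a₀ or b₀, which keeps the clique maximal.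
    a₀ b₀              : V G
    a₀∈clique          : a₀ ∈ clique
    b₀∈clique          : b₀ ∈ clique
    a₀≢b₀              : a₀ ≢ b₀

module AttachBalanced (G : Graph) {m : ℕ} (n′ k′ : ℕ) (S : Fin m → V G)
  (S-injective : Injective _≡_ _≡_ S) (S-onto : ∀ u → Simplicial G u → ∃[ i ] S i ≡ u)
  (S-simplicial : ∀ i → Simplicial G (S i)) (B : Balanced (suc (suc n′)) G) where

  n k : ℕ
  n = suc (suc n′)
  k = suc (suc (suc k′))

  open Attach G k n S
  open Balanced B

  colourW : W → Fin n
  colourW (inj₁ a)           = colour a
  colourW (inj₂ (i , c , j)) = Fin.punchIn (colour (S i)) j

  colourW-proper : ∀ w w′ → Adj w w′ → colourW w ≢ colourW w′
  colourW-proper (inj₁ a) (inj₁ b) a~b = colour-proper a b a~b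
  colourW-proper (inj₁ _) (inj₂ (i , _ , j)) refl = punchInᵢ≢i (colour (S i)) j ∘ sym
  colourW-proper (inj₂ (i , _ , j)) (inj₁ _) refl = punchInᵢ≢i (colour (S i)) j
  colourW-proper (inj₂ (i , _ , j)) (inj₂ (_ , _ , j′)) (refl , refl , j≢j′) = j≢j′ ∘ punchIn-injective (colour (S i)) j j′

  newCount : Fin n → ℕ
  newCount j₀ = sum (λ i → sum (λ c → sum (λ j → 𝟙 (colourW (inj₂ (i , c , j)) Fin.≟ j₀))))

  rootCount : Fin n → ℕ
  rootCount j₀ = sum (λ i → 𝟙 (colour (S i) Fin.≟ j₀))

  rootCount-uniform : ∀ j j′ → rootCount j ≡ rootCount j′
  rootCount-uniform j j′ = begin
    rootCount j                                                   ≡⟨ enumerate j ⟩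
    sum (λ v → 𝟙 (simplicial? v) * 𝟙 (colour v Fin.≟ j))         ≡⟨ simplicial-uniform j j′ ⟩
    sum (λ v → 𝟙 (simplicial? v) * 𝟙 (colour v Fin.≟ j′))        ≡⟨ enumerate j′ ⟨
    rootCount j′                                                  ∎
    where
    open ≡-Reasoning
    enumerate : ∀ j → rootCount j ≡ sum (λ v → 𝟙 (simplicial? v) * 𝟙 (colour v Fin.≟ j))
    enumerate j = sum-enumeration simplicial? S S-injective S-onto S-simplicial (λ v → 𝟙 (colour v Fin.≟ j))

  -- Each colour is used exactly once on every attached clique.
  newCount+rootCount : ∀ j₀ → newCount j₀ + (k ∸ 1) * rootCount j₀ ≡ m * (k ∸ 1)
  newCount+rootCount j₀ = begin
    newCount j₀ + (k ∸ 1) * rootCount j₀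
      ≡⟨ cong₂ _+_ (sum-cong-≗ λ i → sum-const (k ∸ 1) (leaves i)) (*-distribˡ-sum (k ∸ 1) roots) ⟩
    sum (λ i → (k ∸ 1) * leaves i) + sum (λ i → (k ∸ 1) * roots i)  ≡⟨ ∑-distrib-+ (λ i → (k ∸ 1) * leaves i) (λ i → (k ∸ 1) * roots i) ⟨
    sum (λ i → (k ∸ 1) * leaves i + (k ∸ 1) * roots i)
      ≡⟨ sum-cong-≗ (λ i → trans (sym (*-distribˡ-+ (k ∸ 1) (leaves i) (roots i)))
                                  (trans (cong ((k ∸ 1) *_) (sum-𝟙-punchIn (colour (S i)) j₀)) (*-identityʳ (k ∸ 1)))) ⟩
    sum {m} (λ _ → k ∸ 1)                                           ≡⟨ sum-const m (k ∸ 1) ⟩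
    m * (k ∸ 1)                                                     ∎
    where
    open ≡-Reasoning
    leaves roots : Fin m → ℕ
    leaves i = sum (λ j → 𝟙 (Fin.punchIn (colour (S i)) j Fin.≟ j₀))
    roots i = 𝟙 (colour (S i) Fin.≟ j₀)

  newCount-uniform : ∀ j j′ → newCount j ≡ newCount j′
  newCount-uniform j j′ = +-cancelʳ-≡ _ (newCount j) (newCount j′) (begin
    newCount j + (k ∸ 1) * rootCount j     ≡⟨ newCount+rootCount j ⟩
    m * (k ∸ 1)                            ≡⟨ newCount+rootCount j′ ⟨
    newCount j′ + (k ∸ 1) * rootCount j′   ≡⟨ cong (λ r → newCount j′ + (k ∸ 1) * r) (rootCount-uniform j′ j) ⟩
    newCount j′ + (k ∸ 1) * rootCount j    ∎)
    where open ≡-Reasoning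

  colour′ : V G′ → Fin n
  colour′ x = colourW (toW x)

  classSize′ : ∀ j → classSize G′ colour′ j ≡ classSize G colour j + newCount j
  classSize′ j = sum-attach (λ w → 𝟙 (colourW w Fin.≟ j))

  data IsNew : W → Set where
    new : ∀ i c j → IsNew (inj₂ (i , c , j))

  isNew? : ∀ w → Dec (IsNew w)
  isNew? (inj₁ _)           = no λ ()
  isNew? (inj₂ (i , c , j)) = yes (new i c j)

  old-not-simplicial′ : ∀ a → ¬ Simplicial G′ (old a)
  old-not-simplicial′ a with simplicial? a
  ... | yes a-simplicial = let i , Si≡a = S-onto a a-simplicial in
    subst (λ u → ¬ Simplicial G′ (old u)) Si≡a (root-not-simplicial {zero} {suc zero} (λ ()) zero i)
  ... | no ¬a-simplicial =
    old-not-simplicial a ¬a-simplicial λ i a≡Si → ¬a-simplicial (subst (Simplicial G) (sym a≡Si) (S-simplicial i))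

  new⇒simplicial : ∀ x → IsNew (toW x) → Simplicial G′ x
  new⇒simplicial x x-new with toW x | fromW-toW x | x-new
  ... | _ | refl | new i c j = leaf-simplicial i c j

  simplicial⇒new : ∀ x → Simplicial G′ x → IsNew (toW x)
  simplicial⇒new x x-simplicial with toW x | fromW-toW x
  ... | inj₁ a           | refl = ⊥-elim (old-not-simplicial′ a x-simplicial)
  ... | inj₂ (i , c , j) | refl = new i c j

  simplicial′? : ∀ x → Dec (Simplicial G′ x)
  simplicial′? x = map′ (new⇒simplicial x) (simplicial⇒new x) (isNew? (toW x))

  simplicial′-count : ∀ j → sum (λ x → 𝟙 (simplicial′? x) * 𝟙 (colour′ x Fin.≟ j)) ≡ newCount j
  simplicial′-count j = begin
    sum (λ x → 𝟙 (simplicial′? x) * 𝟙 (colour′ x Fin.≟ j))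
      ≡⟨ sum-cong-≗ (λ x → cong (_* 𝟙 (colour′ x Fin.≟ j))
                                 (𝟙-cong (simplicial′? x) (isNew? (toW x)) (simplicial⇒new x) (new⇒simplicial x))) ⟩
    sum (λ x → 𝟙 (isNew? (toW x)) * 𝟙 (colour′ x Fin.≟ j))
      ≡⟨ sum-attach (λ w → 𝟙 (isNew? w) * 𝟙 (colourW w Fin.≟ j)) ⟩
    sum {N} (λ _ → 0) + newCount′
      ≡⟨ cong (_+ newCount′) (sum-zero {N} λ _ → refl) ⟩
    newCount′
      ≡⟨ sum-cong-≗ (λ i → sum-cong-≗ λ c → sum-cong-≗ λ j′ → *-identityˡ (𝟙 (colourW (inj₂ (i , c , j′)) Fin.≟ j))) ⟩
    newCount j ∎
    where
    open ≡-Reasoning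
    newCount′ : ℕ
    newCount′ = sum (λ i → sum (λ c → sum (λ j′ → 1 * 𝟙 (colourW (inj₂ (i , c , j′)) Fin.≟ j))))

  avoids : ∀ i → ∃[ a ] (a ∈ clique × a ≢ S i)
  avoids i with a₀ Fin.≟ S i
  ... | yes a₀≡Si = b₀ , b₀∈clique , λ b₀≡Si → a₀≢b₀ (trans a₀≡Si (sym b₀≡Si))
  ... | no a₀≢Si  = a₀ , a₀∈clique , a₀≢Si

  balanced : Balanced n G′
  balanced = record
    { colour             = colour′
    ; colour-proper      = λ x y → colourW-proper (toW x) (toW y)
    ; classSize-uniform  = λ j j′ → trans (classSize′ j)
        (trans (cong₂ _+_ (classSize-uniform j j′) (newCount-uniform j j′)) (sym (classSize′ j′)))
    ; simplicial?        = simplicial′?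
    ; simplicial-uniform = λ j j′ → trans (simplicial′-count j) (trans (newCount-uniform j j′) (sym (simplicial′-count j′)))
    ; clique             = lift clique
    ; clique-isClique    = lift-clique clique clique-isClique avoids
    ; ∣clique∣≡n         = trans (∣lift∣≡∣∣ clique) ∣clique∣≡n
    ; a₀                 = old a₀
    ; b₀                 = old b₀
    ; a₀∈clique          = old∈lift a₀∈clique
    ; b₀∈clique          = old∈lift b₀∈clique
    ; a₀≢b₀              = a₀≢b₀ ∘ old-injective
    }

K-balanced : ∀ n′ → Balanced (suc (suc n′)) (K (suc (suc n′)))
K-balanced n′ = record
  { colour             = λ v → v
  ; colour-proper      = λ _ _ a≢b → a≢b
  ; classSize-uniform  = λ j j′ → trans (one j) (sym (one j′))
  ; simplicial?        = λ v → yes (⊤ , ⊤-clique , ∈⊤ , λ C C-clique _ → ⊤-unique C C-clique)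
  ; simplicial-uniform = λ j j′ → trans (one′ j) (sym (one′ j′))
  ; clique             = ⊤
  ; clique-isClique    = ⊤-clique
  ; ∣clique∣≡n         = ∣⊤∣≡n n
  ; a₀                 = zero
  ; b₀                 = suc zero
  ; a₀∈clique          = ∈⊤
  ; b₀∈clique          = ∈⊤
  ; a₀≢b₀              = λ ()
  }
  where
  n = suc (suc n′)
  one : ∀ (j : Fin n) → sum (λ v → 𝟙 (v Fin.≟ j)) ≡ 1
  one j = sum-𝟙-injective (λ v → v) (λ eq → eq) j refl
  one′ : ∀ (j : Fin n) → sum (λ v → 1 * 𝟙 (v Fin.≟ j)) ≡ 1
  one′ j = trans (sum-cong-≗ λ v → *-identityˡ (𝟙 (v Fin.≟ j))) (one j)
  ⊤-complete : IsComplete (K n) ⊤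
  ⊤-complete _ _ _ _ a≢b = a≢b
  ⊤-clique : IsClique (K n) ⊤
  ⊤-clique = ⊤-complete , λ _ _ _ _ → ∈⊤
  ⊤-unique : ∀ C → IsClique (K n) C → C ≡ ⊤
  ⊤-unique C (_ , C-maximal) = ⊆-antisym (λ _ → ∈⊤) (C-maximal ⊤ ⊤-complete (λ _ → ∈⊤))

B-balanced : ∀ n′ k′ {l G} → IsB (suc (suc n′)) (suc (suc (suc k′))) l G → Balanced (suc (suc n′)) G
B-balanced n′ k′ base = K-balanced n′
B-balanced n′ k′ (step S B S-injective S-onto S-simplicial) =
  AttachBalanced.balanced _ n′ k′ S S-injective S-onto S-simplicial (B-balanced n′ k′ B)

uniform⇒equitable : ∀ G {t} (c : V G → Fin (suc t)) → Proper G c →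
                    (∀ j j′ → classSize G c j ≡ classSize G c j′) → EquitableColouring G (suc t) c
uniform⇒equitable G {t} c proper uniform = proper , λ j → inj₁ (begin
  ∣ colourClass G c j ∣                ≡⟨ ∣colourClass∣≡classSize G c j ⟩
  classSize G c j                      ≡⟨ m*n/n≡m (classSize G c j) (suc t) ⟨
  classSize G c j * suc t / suc t      ≡⟨ cong (_/ suc t) (size≡ j) ⟨
  size G / suc t                       ∎)
  where
  open ≡-Reasoning
  size≡ : ∀ j → size G ≡ classSize G c j * suc t
  size≡ j = trans (size≡∑classSize G c)
    (trans (sum-cong-≗ λ j′ → uniform j′ j) (trans (sum-const (suc t) _) (*-comm (suc t) _)))

corollary5 : ∀ (l n k : ℕ) → 1 ≤ l → 2 ≤ n → 3 ≤ k →
    ∀ (G : Graph) → IsB n k l G →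
    ∀ (ω αmin χ : ℕ) → IsCliqueNumber G ω → IsAlphaMin G αmin → IsEqChromatic G χ →
    X G ω αmin ≤ χ × χ ≤ suc (X G ω αmin)
corollary5 l (suc (suc n′)) (suc (suc (suc k′))) _ (s≤s (s≤s _)) (s≤s (s≤s (s≤s _))) G G-isB ω αmin χ
  ((C , C-clique , ∣C∣≡ω) , ω-maximum) αmin-spec ((c , c-equitable) , χ-minimum) =
  ⊔-lub ω≤χ ⌈/⌉≤χ , ≤-trans χ≤n (≤-trans n≤ω (≤-trans (m≤m⊔n ω _) (n≤1+n _)))
  where
  open Balanced (B-balanced n′ k′ G-isB)
  n = suc (suc n′)
  ω≤χ : ω ≤ χ
  ω≤χ = subst (_≤ χ) ∣C∣≡ω (∣complete∣≤colours G c (proj₁ c-equitable) C (proj₁ C-clique))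
  ⌈/⌉≤χ : ⌈ suc (size G) / suc αmin ⌉ ≤ χ
  ⌈/⌉≤χ = ⌈suc/suc⌉≤colours G c c-equitable αmin αmin-spec
  χ≤n : χ ≤ n
  χ≤n = χ-minimum n (colour , uniform⇒equitable G colour colour-proper classSize-uniform)
  n≤ω : n ≤ ω
  n≤ω = subst (_≤ ω) ∣clique∣≡n (ω-maximum clique clique-isClique)
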